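{- As an $\mathbb{N}$-semimodule (with scalar multiplication $n\times(p_i)_i=(np_i)_i$), $\mathbf{P}$ has a unique minimal generating set, namely $G=\{\mathbf{p}\in\mathbf{P} : p_0=1\}$, the set of profiles whose first term is $1$; this set $G$ is countably infinite and linearly dependent over $\mathbb{N}$, i.e. there exist finitely many $\mathbf{p}_1,\ldots,\mathbf{p}_m\in G$ and $a_i,b_i\in\mathbb{N}$ with $\sum_i a_i\mathbf{p}_i=\sum_i b_i\mathbf{p}_i$ but $a_i\ne b_i$ for some $i$.
   Context: A profile is a sequence $\mathbf{p}=(p_i)_{i\in\mathbb{N}}$ of natural numbers for which there exists $h\ge -1$ with $p_i\ge 1$ for $0\le i\le h$ and $p_i=0$ for $i>h$ (the null sequence $(0)$ is a profile). $\mathbf{P}$ is the set of profiles, with elementwise sum. A generating set of $\mathbf{P}$ as an $\mathbb{N}$-semimodule is a set $S\subseteq\mathbf{P}$ such that every profile is a finite $\mathbb{N}$-linear combination of elements of $S$; it is minimal if no proper subset is a generating set. -}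

module Defs where

open import Data.Nat using (ℕ; zero; suc; _+_; _*_; _≤_; _<_)
open import Data.Product using (Σ; ∃; _×_; _,_; proj₁; proj₂)
open import Data.List using (List; []; _∷_)
open import Data.List.Relation.Unary.All using (All)
open import Data.List.Relation.Unary.Any using (Any)
open import Data.List.Relation.Unary.AllPairs using (AllPairs)
open import Relation.Binary.PropositionalEquality using (_≡_)
open import Relation.Nullary using (¬_)
open import Function.Bundles using (_⇔_)

Seq : Set
Seq = ℕ → ℕ

-- p is a profile iff there is h ≥ -1 with p_i ≥ 1 for 0 ≤ i ≤ h and p_i = 0 for i > h.
-- We write k = h + 1 ∈ ℕ, so the condition reads: p_i ≥ 1 for i < k, p_i = 0 for i ≥ k.
IsProfile : Seq → Set
IsProfile p = Σ ℕ λ k → (∀ i → i < k → 1 ≤ p i) × (∀ i → k ≤ i → p i ≡ 0)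

Profile : Set
Profile = Σ Seq IsProfile

_≈_ : Profile → Profile → Set
p ≈ q = ∀ i → proj₁ p i ≡ proj₁ q i

PSet : Set₁
PSet = Σ (Profile → Set) λ S → ∀ {p q} → p ≈ q → S p → S q

_∈ₚ_ : Profile → PSet → Set
p ∈ₚ S = proj₁ S p

_⊆ₚ_ : PSet → PSet → Set
S ⊆ₚ T = ∀ p → p ∈ₚ S → p ∈ₚ T

_≐ₚ_ : PSet → PSet → Set
S ≐ₚ T = ∀ p → (p ∈ₚ S) ⇔ (p ∈ₚ T)

lincomb : List (ℕ × Profile) → ℕ → ℕ
lincomb []            i = 0
lincomb ((a , q) ∷ l) i = a * proj₁ q i + lincomb l i

Generating : PSet → Set
Generating S = ∀ (p : Profile) →
  Σ (List (ℕ × Profile)) λ l →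
    All (λ aq → proj₂ aq ∈ₚ S) l × (∀ i → proj₁ p i ≡ lincomb l i)

MinimalGenerating : PSet → Set₁
MinimalGenerating S = Generating S × (∀ (T : PSet) → T ⊆ₚ S → Generating T → S ⊆ₚ T)

G : PSet
G = (λ p → proj₁ p 0 ≡ 1) , λ {p} {q} e h → trans' (e 0) h
  where
  trans' : ∀ {a b c : ℕ} → a ≡ b → a ≡ c → b ≡ c
  trans' Relation.Binary.PropositionalEquality.refl h = h

CountablyInfinite : PSet → Set
CountablyInfinite S = Σ (ℕ → Profile) λ f →
  (∀ n → f n ∈ₚ S) × (∀ m n → f m ≈ f n → m ≡ n) × (∀ p → p ∈ₚ S → ∃ λ n → f n ≈ p)

mapA mapB : List (Profile × ℕ × ℕ) → List (ℕ × Profile)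
mapA [] = []
mapA ((p , a , b) ∷ l) = (a , p) ∷ mapA l
mapB [] = []
mapB ((p , a , b) ∷ l) = (b , p) ∷ mapB l

LinearlyDependent : PSet → Set
LinearlyDependent S = Σ (List (Profile × ℕ × ℕ)) λ l →
  All (λ x → proj₁ x ∈ₚ S) l ×
  AllPairs (λ x y → ¬ (proj₁ x ≈ proj₁ y)) l ×
  (∀ i → lincomb (mapA l) i ≡ lincomb (mapB l) i) ×
  Any (λ x → ¬ (proj₁ (proj₂ x) ≡ proj₂ (proj₂ x))) l

-- A profile with first term 0 is null, so in an ℕ-linear combination of profiles whose first term is 1
-- every summand but one vanishes and the remaining one has coefficient 1: the combination is one of
-- its own terms. Hence every generating set contains G, while G itself generates, since a nonnull
-- profile p is q + (p₀ − 1)·(1,0,0,…) with q ∈ G. A profile in G is determined by the finite list of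
-- its terms after the first, which makes G countably infinite.
module Submission where

open import Defs
open import Data.Nat using (ℕ; zero; suc; _+_; _*_; _≤_; _<_; z≤n; s≤s; pred; NonZero; >-nonZero)
open import Data.Nat.Properties
  using (suc-injective; suc-pred; m+n≡0⇒m≡0; m+n≡0⇒n≡0; m*n≡0⇒m≡0∨n≡0; m*n≡1⇒m≡1;
         *-identityˡ; *-identityʳ; *-zeroʳ; +-identityʳ)
open import Data.Nat.Binary using (ℕᵇ; 2[1+_]; 1+[2_]; toℕ; fromℕ)
import Data.Nat.Binary as ℕᵇ
open import Data.Nat.Binary.Properties using (toℕ-fromℕ; fromℕ-toℕ)
open import Data.Product using (∃; _×_; _,_; proj₁; proj₂)
open import Data.Sum using (_⊎_; inj₁; inj₂)
open import Data.List using (List; []; _∷_; length)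
open import Data.List.Relation.Unary.All using (All; []; _∷_; lookupWith)
import Data.List.Relation.Unary.All as All
open import Data.List.Relation.Unary.Any using (Any; here; there)
import Data.List.Relation.Unary.Any as Any
open import Data.List.Relation.Unary.AllPairs using ([]; _∷_)
open import Function using (_∘_)
open import Function.Bundles using (mk⇔)
open import Relation.Binary.PropositionalEquality
open import Relation.Nullary using (¬_)

-- Reading the lengths of the runs of 2[1+_] separated by 1+[2_] identifies ℕᵇ with ℕ × List ℕ,
-- so ℕ ≅ 1 + ℕᵇ ≅ List ℕ.
runs : ℕᵇ → ℕ × List ℕ
runs ℕᵇ.zero  = 0 , []
runs 1+[2 w ] = 0 , proj₁ (runs w) ∷ proj₂ (runs w)
runs 2[1+ w ] = suc (proj₁ (runs w)) , proj₂ (runs w)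

fromRuns : ℕ → List ℕ → ℕᵇ
fromRuns (suc k) l       = 2[1+ fromRuns k l ]
fromRuns zero    []      = ℕᵇ.zero
fromRuns zero    (k ∷ l) = 1+[2 fromRuns k l ]

fromRuns-runs : ∀ w → fromRuns (proj₁ (runs w)) (proj₂ (runs w)) ≡ w
fromRuns-runs ℕᵇ.zero  = refl
fromRuns-runs 2[1+ w ] = cong 2[1+_] (fromRuns-runs w)
fromRuns-runs 1+[2 w ] = cong 1+[2_] (fromRuns-runs w)

runs-fromRuns : ∀ k l → runs (fromRuns k l) ≡ (k , l)
runs-fromRuns (suc k) l       rewrite runs-fromRuns k l = refl
runs-fromRuns zero    []      = refl
runs-fromRuns zero    (k ∷ l) rewrite runs-fromRuns k l = refl

decode : ℕ → List ℕ
decode zero    = []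
decode (suc n) = proj₁ (runs (fromℕ n)) ∷ proj₂ (runs (fromℕ n))

encode : List ℕ → ℕ
encode []      = 0
encode (k ∷ l) = suc (toℕ (fromRuns k l))

encode-decode : ∀ n → encode (decode n) ≡ n
encode-decode zero    = refl
encode-decode (suc n) = cong suc (trans (cong toℕ (fromRuns-runs (fromℕ n))) (toℕ-fromℕ n))

decode-encode : ∀ l → decode (encode l) ≡ l
decode-encode []      = refl
decode-encode (k ∷ l) rewrite fromℕ-toℕ (fromRuns k l) | runs-fromRuns k l = refl

_∷ₛ_ : ℕ → Seq → Seq
(n ∷ₛ g) zero    = n
(n ∷ₛ g) (suc i) = g i

∷ₛ-isProfile : ∀ {n g} → 1 ≤ n → IsProfile g → IsProfile (n ∷ₛ g)
∷ₛ-isProfile {n} {g} 1≤n (k , lo , hi) = suc k , lo′ , hi′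
  where
  lo′ : ∀ i → i < suc k → 1 ≤ (n ∷ₛ g) i
  lo′ zero    _       = 1≤n
  lo′ (suc i) (s≤s p) = lo i p
  hi′ : ∀ i → suc k ≤ i → (n ∷ₛ g) i ≡ 0
  hi′ (suc i) (s≤s p) = hi i p

tail-isProfile : ∀ {g} → IsProfile g → IsProfile (g ∘ suc)
tail-isProfile (zero  , lo , hi) = zero , (λ _ ()) , λ i _ → hi (suc i) z≤n
tail-isProfile (suc k , lo , hi) = k , (λ i p → lo (suc i) (s≤s p)) , λ i p → hi (suc i) (s≤s p)

head≡0⇒null : (p : Profile) → proj₁ p 0 ≡ 0 → ∀ i → proj₁ p i ≡ 0
head≡0⇒null (g , zero  , lo , hi) _  i = hi i z≤n
head≡0⇒null (g , suc k , lo , hi) g₀≡0 i with g 0 | lo 0 (s≤s z≤n)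
... | zero | ()

-- Profiles with first term 1 are coded by the lists of their later terms, each decreased by 1.

shiftedValues : List ℕ → Seq
shiftedValues []      i       = 0
shiftedValues (x ∷ l) zero    = suc x
shiftedValues (x ∷ l) (suc i) = shiftedValues l i

shiftedValues-isProfile : ∀ l → IsProfile (shiftedValues l)
shiftedValues-isProfile l = length l , lo l , hi l
  where
  lo : ∀ l i → i < length l → 1 ≤ shiftedValues l i
  lo (x ∷ l) zero    _       = s≤s z≤n
  lo (x ∷ l) (suc i) (s≤s p) = lo l i p
  hi : ∀ l i → length l ≤ i → shiftedValues l i ≡ 0
  hi []      i       _       = refl
  hi (x ∷ l) (suc i) (s≤s p) = hi l i p

shiftedValues-injective : ∀ l l′ → shiftedValues l ≗ shiftedValues l′ → l ≡ l′
shiftedValues-injective []      []       _ = refl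
shiftedValues-injective []      (_ ∷ _)  e with () ← e 0
shiftedValues-injective (_ ∷ _) []       e with () ← e 0
shiftedValues-injective (x ∷ l) (y ∷ l′) e =
  cong₂ _∷_ (suc-injective (e 0)) (shiftedValues-injective l l′ (e ∘ suc))

firstValues : Seq → ℕ → List ℕ
firstValues g zero    = []
firstValues g (suc k) = pred (g 0) ∷ firstValues (g ∘ suc) k

shiftedValues-firstValues : ∀ g (pg : IsProfile g) → shiftedValues (firstValues g (proj₁ pg)) ≗ g
shiftedValues-firstValues g (zero  , lo , hi) i       = sym (hi i z≤n)
shiftedValues-firstValues g (suc k , lo , hi) zero    = suc-pred (g 0) {{>-nonZero (lo 0 (s≤s z≤n))}}
shiftedValues-firstValues g (suc k , lo , hi) (suc i) =
  shiftedValues-firstValues (g ∘ suc) (tail-isProfile (suc k , lo , hi)) i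

headOne : List ℕ → Profile
headOne l = 1 ∷ₛ shiftedValues l , ∷ₛ-isProfile (s≤s z≤n) (shiftedValues-isProfile l)

tailCode : Profile → List ℕ
tailCode (g , pg) = firstValues (g ∘ suc) (proj₁ (tail-isProfile pg))

headOne-injective : ∀ l l′ → headOne l ≈ headOne l′ → l ≡ l′
headOne-injective l l′ e = shiftedValues-injective l l′ (e ∘ suc)

headOne-tailCode : ∀ p i → proj₁ (headOne (tailCode p)) (suc i) ≡ proj₁ p (suc i)
headOne-tailCode (g , pg) = shiftedValues-firstValues (g ∘ suc) (tail-isProfile pg)

∈G⇒headOne-tailCode : ∀ p → p ∈ₚ G → headOne (tailCode p) ≈ p
∈G⇒headOne-tailCode p p₀≡1 zero    = sym p₀≡1
∈G⇒headOne-tailCode p p₀≡1 (suc i) = headOne-tailCode p i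

m+n≡1⇒m≡0∧n≡1∨m≡1∧n≡0 : ∀ m {n} → m + n ≡ 1 → (m ≡ 0 × n ≡ 1) ⊎ (m ≡ 1 × n ≡ 0)
m+n≡1⇒m≡0∧n≡1∨m≡1∧n≡0 zero          eq = inj₁ (refl , eq)
m+n≡1⇒m≡0∧n≡1∨m≡1∧n≡0 (suc zero)    eq = inj₂ (refl , suc-injective eq)
m+n≡1⇒m≡0∧n≡1∨m≡1∧n≡0 (suc (suc m)) ()

scaled-head≡0⇒null : ∀ a p → a * proj₁ p 0 ≡ 0 → ∀ i → a * proj₁ p i ≡ 0
scaled-head≡0⇒null a p eq i with m*n≡0⇒m≡0∨n≡0 a eq
... | inj₁ refl = refl
... | inj₂ p₀≡0 = trans (cong (a *_) (head≡0⇒null p p₀≡0 i)) (*-zeroʳ a)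

lincomb-head≡0⇒null : ∀ l → lincomb l 0 ≡ 0 → ∀ i → lincomb l i ≡ 0
lincomb-head≡0⇒null []            _  i = refl
lincomb-head≡0⇒null ((a , q) ∷ l) eq i =
  cong₂ _+_ (scaled-head≡0⇒null a q (m+n≡0⇒m≡0 _ eq) i) (lincomb-head≡0⇒null l (m+n≡0⇒n≡0 _ eq) i)

lincomb-head≡1⇒term : ∀ l → lincomb l 0 ≡ 1 → Any (λ aq → lincomb l ≗ proj₁ (proj₂ aq)) l
lincomb-head≡1⇒term ((a , q) ∷ l) eq with m+n≡1⇒m≡0∧n≡1∨m≡1∧n≡0 (a * proj₁ q 0) eq
... | inj₁ (term≡0 , rest≡1) =
  there (Any.map (λ rest≗q′ i → trans (cong (_+ lincomb l i) (scaled-head≡0⇒null a q term≡0 i)) (rest≗q′ i))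
                 (lincomb-head≡1⇒term l rest≡1))
... | inj₂ (term≡1 , rest≡0) = here λ i → begin
  a * proj₁ q i + lincomb l i ≡⟨ cong₂ _+_ (cong (_* proj₁ q i) (m*n≡1⇒m≡1 a _ term≡1))
                                           (lincomb-head≡0⇒null l rest≡0 i) ⟩
  1 * proj₁ q i + 0           ≡⟨ trans (+-identityʳ _) (*-identityˡ _) ⟩
  proj₁ q i                   ∎
  where open ≡-Reasoning

_∩ₚ_ : PSet → PSet → PSet
S ∩ₚ T = (λ p → p ∈ₚ S × p ∈ₚ T) , λ e (s , t) → proj₂ S e s , proj₂ T e t

∩ₚ-⊆ˡ : ∀ S T → (S ∩ₚ T) ⊆ₚ S
∩ₚ-⊆ˡ S T p (p∈S , _) = p∈S

Generating-mono : ∀ {S T} → S ⊆ₚ T → Generating S → Generating T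
Generating-mono S⊆T genS p with genS p
... | l , l⊆S , p≗l = l , All.map (S⊆T _) l⊆S , p≗l

Generating⇒G⊆ : ∀ S → Generating S → G ⊆ₚ S
Generating⇒G⊆ S genS p p₀≡1 with genS p
... | l , l⊆S , p≗l =
  lookupWith (λ q∈S l≗q → proj₂ S (λ i → sym (trans (p≗l i) (l≗q i))) q∈S) l⊆S
             (lincomb-head≡1⇒term l (trans (sym (p≗l 0)) p₀≡1))

G-generating : Generating G
G-generating (g , zero , lo , hi) = [] , [] , λ i → hi i z≤n
G-generating p@(g , suc k , lo , hi) = terms , refl ∷ refl ∷ [] , p≗terms
  where
  instance
    g₀-nonZero : NonZero (g 0)
    g₀-nonZero = >-nonZero (lo 0 (s≤s z≤n))
  terms : List (ℕ × Profile)
  terms = (1 , headOne (tailCode p)) ∷ (pred (g 0) , headOne []) ∷ []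
  p≗terms : g ≗ lincomb terms
  p≗terms zero = sym (trans (cong suc (trans (+-identityʳ _) (*-identityʳ _))) (suc-pred (g 0)))
  p≗terms (suc i) = sym (begin
    1 * proj₁ (headOne (tailCode p)) (suc i) + (pred (g 0) * 0 + 0)
      ≡⟨ cong₂ _+_ (*-identityˡ _) (trans (+-identityʳ _) (*-zeroʳ (pred (g 0)))) ⟩
    proj₁ (headOne (tailCode p)) (suc i) + 0
      ≡⟨ trans (+-identityʳ _) (headOne-tailCode p i) ⟩
    g (suc i) ∎)
    where open ≡-Reasoning

G-minimalGenerating : MinimalGenerating G
G-minimalGenerating = G-generating , λ T _ genT → Generating⇒G⊆ T genT

MinimalGenerating⇒≐G : ∀ S → MinimalGenerating S → S ≐ₚ G
MinimalGenerating⇒≐G S (genS , minS) p = mk⇔ (λ p∈S → proj₂ (S⊆S∩G p p∈S)) (G⊆S p)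
  where
  G⊆S : G ⊆ₚ S
  G⊆S = Generating⇒G⊆ S genS
  S⊆S∩G : S ⊆ₚ (S ∩ₚ G)
  S⊆S∩G = minS (S ∩ₚ G) (∩ₚ-⊆ˡ S G) (Generating-mono {G} {S ∩ₚ G} (λ q q∈G → G⊆S q q∈G , q∈G) G-generating)

G-countablyInfinite : CountablyInfinite G
G-countablyInfinite = headOne ∘ decode , (λ _ → refl) , injective , surjective
  where
  injective : ∀ m n → headOne (decode m) ≈ headOne (decode n) → m ≡ n
  injective m n e = begin
    m                     ≡⟨ sym (encode-decode m) ⟩
    encode (decode m)     ≡⟨ cong encode (headOne-injective (decode m) (decode n) e) ⟩
    encode (decode n)     ≡⟨ encode-decode n ⟩
    n                     ∎
    where open ≡-Reasoning
  surjective : ∀ p → p ∈ₚ G → ∃ λ n → headOne (decode n) ≈ p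
  surjective p p∈G = encode (tailCode p) ,
    subst (λ l → headOne l ≈ p) (sym (decode-encode (tailCode p))) (∈G⇒headOne-tailCode p p∈G)

-- (1,0,0,…) + (1,2,0,…) = 2·(1,1,0,…)
G-linearlyDependent : LinearlyDependent G
G-linearlyDependent =
  relation , refl ∷ refl ∷ refl ∷ [] , (1≉3 ∷ 1≉2 ∷ []) ∷ (3≉2 ∷ []) ∷ [] ∷ [] , balanced , here (λ ())
  where
  relation : List (Profile × ℕ × ℕ)
  relation = (headOne [] , 1 , 0) ∷ (headOne (1 ∷ []) , 1 , 0) ∷ (headOne (0 ∷ []) , 0 , 2) ∷ []
  1≉3 : ¬ headOne [] ≈ headOne (1 ∷ [])
  1≉3 e with () ← e 1
  1≉2 : ¬ headOne [] ≈ headOne (0 ∷ [])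
  1≉2 e with () ← e 1
  3≉2 : ¬ headOne (1 ∷ []) ≈ headOne (0 ∷ [])
  3≉2 e with () ← e 1
  balanced : lincomb (mapA relation) ≗ lincomb (mapB relation)
  balanced zero          = refl
  balanced (suc zero)    = refl
  balanced (suc (suc i)) = refl

theorem3 : (MinimalGenerating G × (∀ (S : PSet) → MinimalGenerating S → S ≐ₚ G))
    × CountablyInfinite G × LinearlyDependent G
theorem3 = (G-minimalGenerating , MinimalGenerating⇒≐G) , G-countablyInfinite , G-linearlyDependent
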